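{- Let $k$ be an odd positive integer, and suppose there are two primitive solutions $(a, b)$ and $(a',b')$ (i.e. with $\gcd(a,b)=\gcd(a',b')=1$) of $X^2-(k^2+1)Y^2=k^2$ such that $(a, b)$ is equivalent neither to $(a', b')$ nor to $(a',-b')$. Then there exist coprime integers $p,q$, both greater than $1$, with $k=pq$, such that $p^4$ and $q^4$ are each primitively represented by the form $X^2-(k^2+1)Y^2$, i.e. there are coprime integers $u,v$ with $u^2-(k^2+1)v^2=p^4$ and coprime integers $u',v'$ with $u'^2-(k^2+1)v'^2=q^4$.
   Context: For integers $d$ and $n\neq 0$, two solutions $(x,y)$ and $(x',y')$ of $X^2-dY^2=n$ are called equivalent if $xx'\equiv d\,yy' \pmod{n}$ and $xy'\equiv yx' \pmod{n}$. Here $d=k^2+1$ and $n=k^2$. -}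

module Defs where

open import Data.Integer using (ℤ; +_; _+_; _-_; _*_; -_; _^_)
open import Data.Integer.Divisibility using (_∣_)
open import Data.Integer.GCD using (gcd)
open import Relation.Binary.PropositionalEquality using (_≡_)
open import Data.Product using (_×_)

infix 4 _≡_[mod_]
_≡_[mod_] : ℤ → ℤ → ℤ → Set
x ≡ y [mod n ] = n ∣ (x - y)

IsSolution : ℤ → ℤ → ℤ → ℤ → Set
IsSolution d n x y = x * x - d * (y * y) ≡ n

IsPrimitiveSolution : ℤ → ℤ → ℤ → ℤ → Set
IsPrimitiveSolution d n x y = IsSolution d n x y × gcd x y ≡ + 1

Equivalent : ℤ → ℤ → ℤ → ℤ → ℤ → ℤ → Set
Equivalent d n x y x' y' =
  (x * x' ≡ d * (y * y') [mod n ]) × (x * y' ≡ y * x' [mod n ])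

{-# OPTIONS --safe #-}
-- Compose the two solutions both ways: (a + b√d)(a′ ∓ b′√d) = xᵢ + yᵢ√d with xᵢ² − d yᵢ² = k⁴.
-- Then y₁ y₂ = k² (b² − b′²), while k, y₁ and y₂ have no common divisor: such a divisor
-- divides y₂ − y₁ = 2ab′, hence a (k is odd and prime to b and b′), hence d b² = a² − k²,
-- hence d = k² + 1, hence 1. So p = gcd(k, y₁) and q = gcd(k, y₂) are coprime with k = pq;
-- p² divides y₁, and then x₁ as well because b x₁ = a y₁ + k² b′; likewise q² divides x₂
-- and y₂. Dividing (x₁, y₁) by p² represents q⁴ primitively, and (x₂, y₂) by q² represents
-- p⁴. Finally p = 1 would make k² divide x₂ and y₂, i.e. make (a, b) equivalent to
-- (a′, −b′); symmetrically q ≠ 1.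
module Submission where

open import Defs
open import Data.Integer using (ℤ; +_; _+_; _*_; -_; _^_; _<_)
open import Data.Integer.Divisibility using (_∣_)
open import Data.Integer.GCD using (gcd)
open import Relation.Binary.PropositionalEquality using (_≡_)
open import Relation.Nullary using (¬_)
open import Data.Product using (_×_; ∃-syntax)

open import Data.Integer using (_-_; _≤_; 0ℤ; 1ℤ; ∣_∣; +<+; NonZero; >-nonZero)
open import Data.Integer.Properties
  using (abs-*; pos-*; *-comm; *-identityˡ; *-identityʳ; *-cancelˡ-≡; i*j≢0; 0≤i⇒+∣i∣≡i; <⇒≤; <⇒≢; <-trans)
import Data.Integer.Coprimality as ℤ
import Data.Integer.Divisibility.Signed as Signed
open Signed
  using (divides; ∣ᵤ⇒∣; ∣⇒∣ᵤ; ∣-refl; ∣-trans; ∣m∣n⇒∣m+n; ∣m∣n⇒∣m-n; ∣m⇒∣-m; ∣m+n∣m⇒∣n; ∣n⇒∣m*n; ∣m⇒∣m*n)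
  renaming (_∣_ to _∣ˢ_)
import Data.Integer.GCD as ℤ
open import Data.Integer.Tactic.RingSolver using (solve-∀)
open import Data.Nat as ℕ using (ℕ)
import Data.Nat.Properties as ℕ
import Data.Nat.Divisibility as ℕ
import Data.Nat.Coprimality as ℕ
import Data.Nat.GCD as ℕ
open import Data.Nat.Primality using (irreducible[2])
open import Data.Product using (_,_; proj₁; proj₂)
open import Data.Sum using (inj₁; inj₂)
open import Function using (_∘_)
open import Relation.Binary.PropositionalEquality using (module ≡-Reasoning; refl; sym; trans; cong; cong₂; subst; subst₂; _≢_; ≢-sym)
open import Relation.Nullary using (contradiction)

m≡gcd[m,i]*gcd[m,j] : ∀ {m i j} → ℕ.Coprime (ℕ.gcd m i) (ℕ.gcd m j) →
                      m ℕ.* m ℕ.∣ i ℕ.* j → m ≡ ℕ.gcd m i ℕ.* ℕ.gcd m j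
m≡gcd[m,i]*gcd[m,j] {m} {i} {j} g⊥g′ mm∣ij = ℕ.∣-antisym m∣gg′ gg′∣m
  where
  open ℕ.∣-Reasoning
  g g′ : ℕ
  g = ℕ.gcd m i
  g′ = ℕ.gcd m j

  gg′∣m : g ℕ.* g′ ℕ.∣ m
  gg′∣m = ℕ.coprime-factors g⊥g′
    ( ℕ.*-monoʳ-∣ g (ℕ.gcd[m,n]∣m m j)
    , subst (ℕ._∣ g′ ℕ.* m) (ℕ.*-comm g′ g) (ℕ.*-monoʳ-∣ g′ (ℕ.gcd[m,n]∣m m i)))

  m∣ig′ : m ℕ.∣ i ℕ.* g′
  m∣ig′ = begin
    m                           ∣⟨ ℕ.gcd-greatest (ℕ.n∣m*n i) (ℕ.∣-trans (ℕ.m∣m*n m) mm∣ij) ⟩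
    ℕ.gcd (i ℕ.* m) (i ℕ.* j)  ≡⟨ ℕ.c*gcd[m,n]≡gcd[cm,cn] i m j ⟨
    i ℕ.* g′                    ∎

  m∣gg′ : m ℕ.∣ g ℕ.* g′
  m∣gg′ = begin
    m                            ∣⟨ ℕ.gcd-greatest (ℕ.n∣m*n g′) (subst (m ℕ.∣_) (ℕ.*-comm i g′) m∣ig′) ⟩
    ℕ.gcd (g′ ℕ.* m) (g′ ℕ.* i) ≡⟨ ℕ.c*gcd[m,n]≡gcd[cm,cn] g′ m i ⟨
    g′ ℕ.* g                     ≡⟨ ℕ.*-comm g′ g ⟩
    g ℕ.* g′                     ∎

-- Unlike Data.Integer.Coprimality.Coprime, which goes through ∣_∣, this form lets Agda
-- infer the integers involved.
Coprime : ℤ → ℤ → Set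
Coprime i j = ∀ {e} → e ∣ˢ i → e ∣ˢ j → e ∣ˢ 1ℤ

gcd≡1⇒coprime : ∀ {i j} → gcd i j ≡ 1ℤ → Coprime i j
gcd≡1⇒coprime {i} {j} g≡1 {e} e∣i e∣j =
  subst (e ∣ˢ_) g≡1 (∣ᵤ⇒∣ (ℤ.gcd-greatest {i} {j} {e} (∣⇒∣ᵤ e∣i) (∣⇒∣ᵤ e∣j)))

coprime⇒gcd≡1 : ∀ {i j} → Coprime i j → gcd i j ≡ 1ℤ
coprime⇒gcd≡1 {i} {j} i⊥j =
  cong +_ (ℕ.∣1⇒≡1 (∣⇒∣ᵤ (i⊥j {gcd i j} (∣ᵤ⇒∣ (ℤ.gcd[i,j]∣i i j)) (∣ᵤ⇒∣ (ℤ.gcd[i,j]∣j i j)))))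

coprime-divisor : ∀ {i j k} → Coprime i j → i ∣ˢ j * k → i ∣ˢ k
coprime-divisor {i} {j} {k} i⊥j i∣jk =
  ∣ᵤ⇒∣ (ℤ.coprime-divisor i j k (ℕ.gcd≡1⇒coprime (cong ∣_∣ (coprime⇒gcd≡1 i⊥j))) (∣⇒∣ᵤ i∣jk))

coprime-sym : ∀ {i j} → Coprime i j → Coprime j i
coprime-sym i⊥j e∣j e∣i = i⊥j e∣i e∣j

coprime-∣ˡ : ∀ {i j k} → Coprime i j → k ∣ˢ i → Coprime k j
coprime-∣ˡ i⊥j k∣i e∣k = i⊥j (∣-trans e∣k k∣i)

coprime-∣ʳ : ∀ {i j k} → Coprime i j → k ∣ˢ j → Coprime i k
coprime-∣ʳ i⊥j k∣j e∣i e∣k = i⊥j e∣i (∣-trans e∣k k∣j)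

coprime-*ˡ : ∀ {i j k} → Coprime i k → Coprime j k → Coprime (i * j) k
coprime-*ˡ i⊥k j⊥k e∣ij e∣k =
  j⊥k (coprime-divisor (λ f∣e f∣i → i⊥k f∣i (∣-trans f∣e e∣k)) e∣ij) e∣k

coprime-^ˡ : ∀ {i j} n → Coprime i j → Coprime (i ^ n) j
coprime-^ˡ ℕ.zero    i⊥j e∣1 _ = e∣1
coprime-^ˡ (ℕ.suc n) i⊥j = coprime-*ˡ i⊥j (coprime-^ˡ n i⊥j)

-- (a + b√d)(a′ − b′√d) = composeˣ d a b a′ b′ + composeʸ a b a′ b′ √d
composeˣ : ℤ → ℤ → ℤ → ℤ → ℤ → ℤ
composeˣ d a b a′ b′ = a * a′ - d * (b * b′)

composeʸ : ℤ → ℤ → ℤ → ℤ → ℤ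
composeʸ a b a′ b′ = a′ * b - a * b′

DividesComposition : ℤ → ℤ → ℤ → ℤ → ℤ → ℤ → Set
DividesComposition c d a b a′ b′ = c ∣ˢ composeˣ d a b a′ b′ × c ∣ˢ composeʸ a b a′ b′

composition-solution : ∀ d {n n′} a b a′ b′ → IsSolution d n a b → IsSolution d n′ a′ b′ →
                       IsSolution d (n * n′) (composeˣ d a b a′ b′) (composeʸ a b a′ b′)
composition-solution d a b a′ b′ sol sol′ =
  trans (brahmagupta d a b a′ b′) (cong₂ _*_ sol sol′)
  where
  brahmagupta : ∀ d a b a′ b′ →
    (a * a′ - d * (b * b′)) * (a * a′ - d * (b * b′)) - d * ((a′ * b - a * b′) * (a′ * b - a * b′))
      ≡ (a * a - d * (b * b)) * (a′ * a′ - d * (b′ * b′))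
  brahmagupta = solve-∀

solution-neg : ∀ {n} d x y → IsSolution d n x y → IsSolution d n x (- y)
solution-neg d x y sol = trans (cong (λ z → x * x - d * z) (neg*neg y)) sol
  where
  neg*neg : ∀ y → - y * - y ≡ y * y
  neg*neg = solve-∀

∣composeʸ*composeʸ : ∀ {n} d a b a′ b′ → IsSolution d n a b → IsSolution d n a′ b′ →
                     n ∣ˢ composeʸ a b a′ b′ * composeʸ a b a′ (- b′)
∣composeʸ*composeʸ {n} d a b a′ b′ sol sol′ = divides (b * b - b′ * b′) (begin
  (a′ * b - a * b′) * (a′ * b - a * - b′)                    ≡⟨ difference-of-norms d a b a′ b′ ⟩
  (a′ * a′ - d * (b′ * b′)) * (b * b) - (a * a - d * (b * b)) * (b′ * b′)
                                                             ≡⟨ cong₂ (λ m m′ → m′ * (b * b) - m * (b′ * b′)) sol sol′ ⟩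
  n * (b * b) - n * (b′ * b′)                                ≡⟨ factor n (b * b) (b′ * b′) ⟩
  (b * b - b′ * b′) * n                                      ∎)
  where
  open ≡-Reasoning
  difference-of-norms : ∀ d a b a′ b′ →
    (a′ * b - a * b′) * (a′ * b - a * - b′)
      ≡ (a′ * a′ - d * (b′ * b′)) * (b * b) - (a * a - d * (b * b)) * (b′ * b′)
  difference-of-norms = solve-∀
  factor : ∀ n u v → n * u - n * v ≡ (u - v) * n
  factor = solve-∀

∣composeʸ⇒∣composeˣ : ∀ {c n} d a b a′ b′ → IsSolution d n a b → Coprime c b → c ∣ˢ n →
                      c ∣ˢ composeʸ a b a′ b′ → c ∣ˢ composeˣ d a b a′ b′
∣composeʸ⇒∣composeˣ {c} {n} d a b a′ b′ sol c⊥b c∣n c∣y =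
  coprime-divisor c⊥b (subst (c ∣ˢ_) (sym b*x≡a*y+n*b′) (∣m∣n⇒∣m+n (∣n⇒∣m*n a c∣y) (∣m⇒∣m*n b′ c∣n)))
  where
  expand : ∀ d a b a′ b′ →
    b * (a * a′ - d * (b * b′)) ≡ a * (a′ * b - a * b′) + (a * a - d * (b * b)) * b′
  expand = solve-∀
  b*x≡a*y+n*b′ : b * composeˣ d a b a′ b′ ≡ a * composeʸ a b a′ b′ + n * b′
  b*x≡a*y+n*b′ = trans (expand d a b a′ b′) (cong (λ m → a * composeʸ a b a′ b′ + m * b′) sol)

primitive⇒coprime : ∀ {c n} d x y → c ∣ˢ n → IsPrimitiveSolution d n x y → Coprime c y
primitive⇒coprime {c} {n} d x y c∣n (sol , gcd≡1) {e} e∣c e∣y =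
  coprime-*ˡ x⊥y x⊥y (subst (e ∣ˢ_) (sym x*x≡n+d*y*y) e∣n+d*y*y) e∣y
  where
  x⊥y : Coprime x y
  x⊥y = gcd≡1⇒coprime gcd≡1
  e∣n+d*y*y : e ∣ˢ n + d * (y * y)
  e∣n+d*y*y = ∣m∣n⇒∣m+n (∣-trans e∣c c∣n) (∣n⇒∣m*n d (∣n⇒∣m*n y e∣y))
  x*x≡n+d*y*y : x * x ≡ n + d * (y * y)
  x*x≡n+d*y*y = trans (sub-add (x * x) (d * (y * y))) (cong (_+ d * (y * y)) sol)
    where
    sub-add : ∀ u v → u ≡ (u - v) + v
    sub-add = solve-∀

odd⇒coprime-2 : ∀ {i} → ¬ (+ 2 ∣ i) → Coprime i (+ 2)
odd⇒coprime-2 {i} 2∤i e∣i e∣2 with irreducible[2] (∣⇒∣ᵤ e∣2)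
... | inj₁ ∣e∣≡1 = ∣ᵤ⇒∣ (ℕ.∣-reflexive ∣e∣≡1)
... | inj₂ ∣e∣≡2 = contradiction (subst (ℕ._∣ ∣ i ∣) ∣e∣≡2 (∣⇒∣ᵤ e∣i)) 2∤i

common-divisor-of-composeʸ-∣1 : ∀ {k e} a b a′ b′ → ¬ (+ 2 ∣ k) →
  IsSolution (k ^ 2 + 1ℤ) (k ^ 2) a b → Coprime k b → Coprime k b′ →
  e ∣ˢ k → e ∣ˢ composeʸ a b a′ b′ → e ∣ˢ composeʸ a b a′ (- b′) → e ∣ˢ 1ℤ
common-divisor-of-composeʸ-∣1 {k} {e} a b a′ b′ k-odd sol k⊥b k⊥b′ e∣k e∣y₁ e∣y₂ =
  ∣m+n∣m⇒∣n e∣d e∣k²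
  where
  e∣k² : e ∣ˢ k ^ 2
  e∣k² = ∣m⇒∣m*n (k * 1ℤ) e∣k
  e∣b′a : e ∣ˢ b′ * a
  e∣b′a = coprime-divisor (odd⇒coprime-2 λ 2∣e → k-odd (ℕ.∣-trans 2∣e (∣⇒∣ᵤ e∣k)))
    (subst (e ∣ˢ_) (y₂-y₁ a b a′ b′) (∣m∣n⇒∣m-n e∣y₂ e∣y₁))
    where
    y₂-y₁ : ∀ a b a′ b′ → (a′ * b - a * - b′) - (a′ * b - a * b′) ≡ + 2 * (b′ * a)
    y₂-y₁ = solve-∀
  e∣a : e ∣ˢ a
  e∣a = coprime-divisor (coprime-∣ˡ k⊥b′ e∣k) e∣b′a
  e∣d : e ∣ˢ k ^ 2 + 1ℤ
  e∣d = coprime-divisor (coprime-sym (coprime-*ˡ b⊥e b⊥e))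
    (subst (e ∣ˢ_) a*a-k²≡b*b*d (∣m∣n⇒∣m-n (∣n⇒∣m*n a e∣a) e∣k²))
    where
    b⊥e : Coprime b e
    b⊥e = coprime-sym (coprime-∣ˡ k⊥b e∣k)
    cancel : ∀ u v w → u - (u - v * w) ≡ w * v
    cancel = solve-∀
    a*a-k²≡b*b*d : a * a - k ^ 2 ≡ (b * b) * (k ^ 2 + 1ℤ)
    a*a-k²≡b*b*d = trans (cong (λ m → a * a - m) (sym sol)) (cancel (a * a) (k ^ 2 + 1ℤ) (b * b))

^2-mono-∣ : ∀ {i j} → i ∣ˢ j → i ^ 2 ∣ˢ j ^ 2
^2-mono-∣ {i} (divides q refl) = divides (q * q) (square-* q i)
  where
  square-* : ∀ q i → q * i * (q * i * + 1) ≡ q * q * (i * (i * + 1))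
  square-* = solve-∀

square-divides-composition : ∀ {c k y′} d a b a′ b′ → IsSolution d (k ^ 2) a b → Coprime k b →
  c ∣ˢ k → Coprime c y′ → k ^ 2 ∣ˢ y′ * composeʸ a b a′ b′ → DividesComposition (c ^ 2) d a b a′ b′
square-divides-composition {c} {k} d a b a′ b′ sol k⊥b c∣k c⊥y′ k²∣y′y =
  ∣composeʸ⇒∣composeˣ d a b a′ b′ sol (coprime-^ˡ 2 (coprime-∣ˡ k⊥b c∣k)) c²∣k² c²∣y , c²∣y
  where
  c²∣k² : c ^ 2 ∣ˢ k ^ 2
  c²∣k² = ^2-mono-∣ c∣k
  c²∣y : c ^ 2 ∣ˢ composeʸ a b a′ b′
  c²∣y = coprime-divisor (coprime-^ˡ 2 c⊥y′) (∣-trans c²∣k² k²∣y′y)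

dividesComposition⇒equivalent : ∀ {n} d a b a′ b′ →
  DividesComposition n d a b a′ b′ → Equivalent d n a b a′ b′
dividesComposition⇒equivalent {n} d a b a′ b′ (n∣x , n∣y) =
  ∣⇒∣ᵤ n∣x , ∣⇒∣ᵤ (subst (n ∣ˢ_) (neg-composeʸ a b a′ b′) (∣m⇒∣-m n∣y))
  where
  neg-composeʸ : ∀ a b a′ b′ → - (a′ * b - a * b′) ≡ a * b′ - b * a′
  neg-composeʸ = solve-∀

primitive-quotient : ∀ {k x y} d c s .{{_ : NonZero c}} → k ≡ c * s → c ^ 2 ∣ˢ x → c ^ 2 ∣ˢ y →
  IsSolution d (k ^ 2 * k ^ 2) x y → Coprime y s → ∃[ u ] ∃[ v ] IsPrimitiveSolution d (s ^ 4) u v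
primitive-quotient d c s refl (divides u refl) (divides v refl) sol y⊥s =
  u , v , norm≡s⁴ , coprime⇒gcd≡1 u⊥v
  where
  instance
    c²≢0 : NonZero (c * c)
    c²≢0 = i*j≢0 c c
    c⁴≢0 : NonZero (c * c * (c * c))
    c⁴≢0 = i*j≢0 (c * c) (c * c)

  scale-norm : ∀ c u v d →
    c * c * (c * c) * (u * u - d * (v * v))
      ≡ u * (c * (c * + 1)) * (u * (c * (c * + 1))) - d * (v * (c * (c * + 1)) * (v * (c * (c * + 1))))
  scale-norm = solve-∀
  fourth-power-* : ∀ c s → (c * s) * ((c * s) * + 1) * ((c * s) * ((c * s) * + 1))
                           ≡ c * c * (c * c) * (s * (s * (s * (s * + 1))))
  fourth-power-* = solve-∀

  norm≡s⁴ : u * u - d * (v * v) ≡ s ^ 4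
  norm≡s⁴ = *-cancelˡ-≡ (c * c * (c * c)) _ _ (trans (scale-norm c u v d) (trans sol (fourth-power-* c s)))

  v⊥s⁴ : Coprime v (s ^ 4)
  v⊥s⁴ = coprime-sym (coprime-^ˡ 4 (coprime-sym (coprime-∣ˡ y⊥s (∣m⇒∣m*n (c ^ 2) ∣-refl))))

  u⊥v : Coprime u v
  u⊥v {e} e∣u e∣v = v⊥s⁴ e∣v
    (subst (e ∣ˢ_) norm≡s⁴ (∣m∣n⇒∣m-n (∣n⇒∣m*n u e∣u) (∣n⇒∣m*n d (∣n⇒∣m*n v e∣v))))

k≡gcd[k,i]*gcd[k,j] : ∀ {k} i j → 0ℤ ≤ k → Coprime (gcd k i) (gcd k j) → k ^ 2 ∣ˢ i * j →
                      k ≡ gcd k i * gcd k j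
k≡gcd[k,i]*gcd[k,j] {k} i j 0≤k g⊥g′ k²∣ij = begin
  k                  ≡⟨ 0≤i⇒+∣i∣≡i 0≤k ⟨
  + ∣ k ∣            ≡⟨ cong +_ (m≡gcd[m,i]*gcd[m,j] ℕ-g⊥g′ ℕ-k²∣ij) ⟩
  + (g ℕ.* g′)       ≡⟨ pos-* g g′ ⟩
  gcd k i * gcd k j  ∎
  where
  open ≡-Reasoning
  g g′ : ℕ
  g = ℕ.gcd ∣ k ∣ ∣ i ∣
  g′ = ℕ.gcd ∣ k ∣ ∣ j ∣
  ℕ-g⊥g′ : ℕ.Coprime g g′
  ℕ-g⊥g′ = ℕ.gcd≡1⇒coprime (cong ∣_∣ (coprime⇒gcd≡1 g⊥g′))
  ∣k²∣ : ∣ k ^ 2 ∣ ≡ ∣ k ∣ ℕ.* ∣ k ∣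
  ∣k²∣ = trans (abs-* k (k * 1ℤ)) (cong (λ m → ∣ k ∣ ℕ.* ∣ m ∣) (*-identityʳ k))
  ℕ-k²∣ij : ∣ k ∣ ℕ.* ∣ k ∣ ℕ.∣ ∣ i ∣ ℕ.* ∣ j ∣
  ℕ-k²∣ij = subst₂ ℕ._∣_ ∣k²∣ (abs-* i j) (∣⇒∣ᵤ k²∣ij)

1<gcd : ∀ i j → i ≢ 0ℤ → gcd i j ≢ 1ℤ → 1ℤ < gcd i j
1<gcd i j i≢0 g≢1 = +<+ (ℕ.≤∧≢⇒< (ℕ.n≢0⇒n>0 g≢0) (g≢1 ∘ cong +_ ∘ sym))
  where
  g≢0 : ℕ.gcd ∣ i ∣ ∣ j ∣ ≢ 0
  g≢0 g≡0 = i≢0 (ℤ.gcd[i,j]≡0⇒i≡0 i j (cong +_ g≡0))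

cofactor≢1 : ∀ {k p q} d a b a′ b′ → k ≡ p * q → DividesComposition (q ^ 2) d a b a′ b′ →
             ¬ Equivalent d (k ^ 2) a b a′ b′ → p ≢ 1ℤ
cofactor≢1 {k} {p} {q} d a b a′ b′ k≡pq q²∣composition ≁ p≡1 =
  ≁ (dividesComposition⇒equivalent d a b a′ b′
      (subst (λ c → DividesComposition (c ^ 2) d a b a′ b′) q≡k q²∣composition))
  where
  q≡k : q ≡ k
  q≡k = trans (sym (*-identityˡ q)) (trans (cong (_* q) (sym p≡1)) (sym k≡pq))

module TwoSolutions (k a b a′ b′ : ℤ) (0<k : + 0 < k) (k-odd : ¬ (+ 2 ∣ k))
  (prim : IsPrimitiveSolution (k ^ 2 + 1ℤ) (k ^ 2) a b)
  (prim′ : IsPrimitiveSolution (k ^ 2 + 1ℤ) (k ^ 2) a′ b′) where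

  d y₁ y₂ p q : ℤ
  d = k ^ 2 + 1ℤ
  y₁ = composeʸ a b a′ b′
  y₂ = composeʸ a b a′ (- b′)
  p = gcd k y₁
  q = gcd k y₂

  sol : IsSolution d (k ^ 2) a b
  sol = proj₁ prim
  sol′ : IsSolution d (k ^ 2) a′ b′
  sol′ = proj₁ prim′

  k∣k² : k ∣ˢ k ^ 2
  k∣k² = ∣m⇒∣m*n (k * 1ℤ) ∣-refl
  k⊥b : Coprime k b
  k⊥b = primitive⇒coprime d a b k∣k² prim

  common-divisor-∣1 : ∀ {e} → e ∣ˢ k → e ∣ˢ y₁ → e ∣ˢ y₂ → e ∣ˢ 1ℤ
  common-divisor-∣1 = common-divisor-of-composeʸ-∣1 a b a′ b′ k-odd sol k⊥b
    (primitive⇒coprime d a′ b′ k∣k² prim′)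

  p∣k : p ∣ˢ k
  p∣k = ∣ᵤ⇒∣ (ℤ.gcd[i,j]∣i k y₁)
  q∣k : q ∣ˢ k
  q∣k = ∣ᵤ⇒∣ (ℤ.gcd[i,j]∣i k y₂)
  q∣y₂ : q ∣ˢ y₂
  q∣y₂ = ∣ᵤ⇒∣ (ℤ.gcd[i,j]∣j k y₂)

  p⊥y₂ : Coprime p y₂
  p⊥y₂ e∣p = common-divisor-∣1 (∣-trans e∣p p∣k) (∣-trans e∣p (∣ᵤ⇒∣ (ℤ.gcd[i,j]∣j k y₁)))
  q⊥y₁ : Coprime q y₁
  q⊥y₁ e∣q e∣y₁ = common-divisor-∣1 (∣-trans e∣q q∣k) e∣y₁ (∣-trans e∣q q∣y₂)
  p⊥q : Coprime p q
  p⊥q = coprime-∣ʳ p⊥y₂ q∣y₂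

  k²∣y₁y₂ : k ^ 2 ∣ˢ y₁ * y₂
  k²∣y₁y₂ = ∣composeʸ*composeʸ d a b a′ b′ sol sol′
  k≡pq : k ≡ p * q
  k≡pq = k≡gcd[k,i]*gcd[k,j] y₁ y₂ (<⇒≤ 0<k) p⊥q k²∣y₁y₂

  p²∣composition : DividesComposition (p ^ 2) d a b a′ b′
  p²∣composition = square-divides-composition d a b a′ b′ sol k⊥b p∣k p⊥y₂
    (subst (k ^ 2 ∣ˢ_) (*-comm y₁ y₂) k²∣y₁y₂)
  q²∣composition⁻ : DividesComposition (q ^ 2) d a b a′ (- b′)
  q²∣composition⁻ = square-divides-composition d a b a′ (- b′) sol k⊥b q∣k q⊥y₁ k²∣y₁y₂

lemma4p3 : (k : ℤ) → + 0 < k → ¬ (+ 2 ∣ k) →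
    (a b a' b' : ℤ) →
    IsPrimitiveSolution (k ^ 2 + + 1) (k ^ 2) a b →
    IsPrimitiveSolution (k ^ 2 + + 1) (k ^ 2) a' b' →
    ¬ Equivalent (k ^ 2 + + 1) (k ^ 2) a b a' b' →
    ¬ Equivalent (k ^ 2 + + 1) (k ^ 2) a b a' (- b') →
    ∃[ p ] ∃[ q ] (gcd p q ≡ + 1 × + 1 < p × + 1 < q × k ≡ p * q ×
      (∃[ u ] ∃[ v ] IsPrimitiveSolution (k ^ 2 + + 1) (p ^ 4) u v) ×
      (∃[ u' ] ∃[ v' ] IsPrimitiveSolution (k ^ 2 + + 1) (q ^ 4) u' v'))
lemma4p3 k 0<k k-odd a b a′ b′ prim prim′ ≁ ≁⁻ =
  p , q , coprime⇒gcd≡1 p⊥q , 1<p , 1<q , k≡pq ,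
  primitive-quotient d q p k≡qp (proj₁ q²∣composition⁻) (proj₂ q²∣composition⁻)
    (composition-solution d a b a′ (- b′) sol (solution-neg d a′ b′ sol′)) (coprime-sym p⊥y₂) ,
  primitive-quotient d p q k≡pq (proj₁ p²∣composition) (proj₂ p²∣composition)
    (composition-solution d a b a′ b′ sol sol′) (coprime-sym q⊥y₁)
  where
  open TwoSolutions k a b a′ b′ 0<k k-odd prim prim′

  k≡qp : k ≡ q * p
  k≡qp = trans k≡pq (*-comm p q)
  k≢0 : k ≢ 0ℤ
  k≢0 = ≢-sym (<⇒≢ 0<k)
  1<p : 1ℤ < p
  1<p = 1<gcd k y₁ k≢0 (cofactor≢1 d a b a′ (- b′) k≡pq q²∣composition⁻ ≁⁻)
  1<q : 1ℤ < q
  1<q = 1<gcd k y₂ k≢0 (cofactor≢1 d a b a′ b′ k≡qp p²∣composition ≁)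

  instance
    p≢0 : NonZero p
    p≢0 = >-nonZero (<-trans (+<+ ℕ.z<s) 1<p)
    q≢0 : NonZero q
    q≢0 = >-nonZero (<-trans (+<+ ℕ.z<s) 1<q)
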